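{- Let $\mathcal M=(E,\rho)$ be a $q$-matroid and $P(\mathcal M)$ its projectivization matroid. Then $\chi_{\mathcal M}(x)=\chi_{P(\mathcal M)}(x)$.
   Context: A $q$-matroid is a pair $(E,\rho)$ where $E$ is a finite-dimensional vector space over the finite field $\mathbb F_q$ and $\rho$ assigns to each subspace of $E$ a nonnegative integer such that $0\le\rho(V)\le\dim V$, $V\le W\Rightarrow\rho(V)\le\rho(W)$, and $\rho(V+W)+\rho(V\cap W)\le\rho(V)+\rho(W)$. $\mathbb PE$ denotes the set of $1$-dimensional subspaces of $E$; for $S\subseteq\mathbb PE$, $\langle S\rangle$ is the span of the union of the lines in $S$. The projectivization matroid is $P(\mathcal M)=(\mathbb PE,r)$ with $r(S)=\rho(\langle S\rangle)$. The characteristic polynomial of $\mathcal M$ is $\chi_{\mathcal M}(x)=\sum_{V\le E}\mu_{\mathcal L(E)}(\{0\},V)\,x^{\rho(E)-\rho(V)}$, where $\mu_{\mathcal L(E)}$ is the Möbius function of the lattice of subspaces of $E$. The characteristic polynomial of a matroid $M=(S,r)$ is $\chi_M(x)=\sum_{A\subseteq S}(-1)^{|A|}x^{r(S)-r(A)}$. -}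

module Defs where

open import Data.Nat using (ℕ; zero; suc; _∸_; _≤_; _⊔_; _≡ᵇ_)
open import Data.Bool using (Bool; true; false; _∧_; _∨_; not; if_then_else_; T)
open import Data.Fin using (Fin)
import Data.Fin.Properties as FinP
open import Data.Vec using (Vec; []; _∷_; zipWith; replicate)
import Data.Vec as Vec
import Data.Vec.Properties as VecP
open import Data.List using (List; []; _∷_; _++_; map; concatMap; filterᵇ; upTo; allFin; length; foldr)
open import Data.Bool.ListAction using (all; any)
open import Data.Integer using (ℤ; +_) renaming (_+_ to _+ℤ_; -_ to negℤ)
open import Data.Product using (∃)
open import Relation.Nullary using (does)
open import Relation.Binary.PropositionalEquality using (_≡_; _≢_)
open import Algebra.Structures using (IsCommutativeRing)

-- A finite field with q elements, carried (w.l.o.g.) by Fin q.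

record FiniteField (q : ℕ) : Set where
  field
    _+_ _*_ : Fin q → Fin q → Fin q
    -_      : Fin q → Fin q
    0# 1#   : Fin q
    isCommutativeRing : IsCommutativeRing _≡_ _+_ _*_ -_ 0# 1#
    0≢1     : 0# ≢ 1#
    inverse : ∀ x → x ≢ 0# → ∃ λ y → x * y ≡ 1#

sumℤ : List ℤ → ℤ
sumℤ = foldr _+ℤ_ (+ 0)

-- all sublists (= all subsets of a duplicate-free list, each exactly once)
sublists : ∀ {A : Set} → List A → List (List A)
sublists [] = [] ∷ []
sublists (x ∷ xs) = map (x ∷_) (sublists xs) ++ sublists xs

tuples : ∀ {A : Set} → List A → (k : ℕ) → List (Vec A k)
tuples xs zero = [] ∷ []
tuples xs (suc k) = concatMap (λ x → map (x ∷_) (tuples xs k)) xs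

sign : ℕ → ℤ
sign zero = + 1
sign (suc m) = negℤ (sign m)

-- Recursion is on a fuel parameter; fuel = (number of elements + 1) suffices.
module Möbius {A : Set} (elems : List A) (_≤?_ : A → A → Bool) (_==_ : A → A → Bool) where
  μ-fuel : ℕ → A → A → ℤ
  μ-fuel zero x y = + 0
  μ-fuel (suc k) x y =
    if x == y then + 1
    else if x ≤? y
      then negℤ (sumℤ (map (μ-fuel k x) (filterᵇ (λ z → (x ≤? z) ∧ (z ≤? y) ∧ not (z == y)) elems)))
      else + 0

  μ : A → A → ℤ
  μ = μ-fuel (suc (length elems))

-- The ambient space E = F_q^n, subsets of E as boolean predicates.

module Space {q : ℕ} (F : FiniteField q) (n : ℕ) where
  open FiniteField F

  Vector : Set
  Vector = Vec (Fin q) n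

  SubsetE : Set
  SubsetE = Vector → Bool

  _=ᵛ_ : ∀ {m} → Vec (Fin q) m → Vec (Fin q) m → Bool
  u =ᵛ v = does (VecP.≡-dec FinP._≟_ u v)

  _⊕_ : ∀ {m} → Vec (Fin q) m → Vec (Fin q) m → Vec (Fin q) m
  _⊕_ = zipWith _+_

  _·_ : ∀ {m} → Fin q → Vec (Fin q) m → Vec (Fin q) m
  c · v = Vec.map (c *_) v

  zeroV : ∀ {m} → Vec (Fin q) m
  zeroV = replicate _ 0#

  allVecs : (m : ℕ) → List (Vec (Fin q) m)
  allVecs m = tuples (allFin q) m

  allE : List Vector
  allE = allVecs n

  isSubspace : SubsetE → Bool
  isSubspace V =
    V zeroV
    ∧ all (λ u → all (λ v → not (V u ∧ V v) ∨ V (u ⊕ v)) allE) allE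
    ∧ all (λ c → all (λ v → not (V v) ∨ V (c · v)) allE) (allFin q)

  IsSubspace : SubsetE → Set
  IsSubspace V = T (isSubspace V)

  _⊆?_ : SubsetE → SubsetE → Bool
  V ⊆? W = all (λ v → not (V v) ∨ W v) allE

  _⊆_ : SubsetE → SubsetE → Set
  V ⊆ W = T (V ⊆? W)

  _==ˢ_ : SubsetE → SubsetE → Bool
  V ==ˢ W = (V ⊆? W) ∧ (W ⊆? V)

  fromList : List Vector → SubsetE
  fromList xs v = any (v =ᵛ_) xs

  -- the list of all subspaces of E (each exactly once)
  subspaces : List SubsetE
  subspaces = filterᵇ isSubspace (map fromList (sublists allE))

  span : SubsetE → SubsetE
  span S v = all (λ W → not (S ⊆? W) ∨ W v) subspaces

  _∩_ : SubsetE → SubsetE → SubsetE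
  (V ∩ W) v = V v ∧ W v

  _+ˢ_ : SubsetE → SubsetE → SubsetE
  V +ˢ W = span (λ v → V v ∨ W v)

  fullE : SubsetE
  fullE _ = true

  zeroSub : SubsetE
  zeroSub v = v =ᵛ zeroV

  lincomb : ∀ {k} → Vec (Fin q) k → Vec Vector k → Vector
  lincomb [] [] = zeroV
  lincomb (c ∷ cs) (v ∷ vs) = (c · v) ⊕ lincomb cs vs

  independent : ∀ {k} → Vec Vector k → Bool
  independent {k} vs =
    all (λ c → not (lincomb c vs =ᵛ zeroV) ∨ (c =ᵛ zeroV)) (allVecs k)

  dim : SubsetE → ℕ
  dim V = foldr _⊔_ 0
    (map (λ k → if any independent (tuples (filterᵇ V allE) k) then k else 0)
         (upTo (suc n)))

  open Möbius subspaces _⊆?_ _==ˢ_ public using (μ)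

  lines : List SubsetE
  lines = filterᵇ (λ L → dim L ≡ᵇ 1) subspaces

  ⟨_⟩ : List SubsetE → SubsetE
  ⟨ A ⟩ = span (λ v → any (λ L → L v) A)

record QMatroid {q : ℕ} (F : FiniteField q) (n : ℕ) : Set where
  open Space F n
  field
    ρ      : SubsetE → ℕ
    -- subsets are extensional
    ρ-ext  : ∀ V W → (∀ v → V v ≡ W v) → ρ V ≡ ρ W
    ρ-dim  : ∀ V → IsSubspace V → ρ V ≤ dim V
    ρ-mono : ∀ V W → IsSubspace V → IsSubspace W → V ⊆ W → ρ V ≤ ρ W
    ρ-sub  : ∀ V W → IsSubspace V → IsSubspace W →
             ρ (V +ˢ W) Data.Nat.+ ρ (V ∩ W) ≤ ρ V Data.Nat.+ ρ W

module _ {q : ℕ} {F : FiniteField q} {n : ℕ} (M : QMatroid F n) where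
  open Space F n
  open QMatroid M

  -- projectivization matroid P(M) = (PE, r), r(S) = ρ(⟨S⟩)
  r : List SubsetE → ℕ
  r S = ρ ⟨ S ⟩

  -- polynomials are represented by their coefficient sequences ℕ → ℤ

  -- χ_M(x) = Σ_{V ≤ E} μ(0,V) x^{ρ(E) - ρ(V)} : coefficient of x^k
  χq : ℕ → ℤ
  χq k = sumℤ (map (μ zeroSub) (filterᵇ (λ V → (ρ fullE ∸ ρ V) ≡ᵇ k) subspaces))

  -- χ_{P(M)}(x) = Σ_{A ⊆ PE} (-1)^{|A|} x^{r(PE) - r(A)} : coefficient of x^k
  χP : ℕ → ℤ
  χP k = sumℤ (map (λ A → sign (length A))
                   (filterᵇ (λ A → (r lines ∸ r A) ≡ᵇ k) (sublists lines)))

module Submission where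

-- Write ν V for the signed count of the sets A of lines with ⟨ A ⟩ = V, each counted with sign
-- (-1)^|A|. Summing ν over the subspaces below V counts, with sign, all sets of lines contained
-- in V; this is 1 if V = 0 and 0 otherwise, because a nonzero subspace contains a line and the
-- alternating sum over the subsets of a nonempty set vanishes. These are the relations defining
-- μ(0, V) in the subspace lattice, so ν V = μ(0, V). Substituting this into χ_M and regrouping
-- the sum by the sets A of lines, using ρ E = ρ ⟨ PE ⟩, gives χ_{P(M)}.

open import Defs
open import Data.Nat using (ℕ)
open import Relation.Binary.PropositionalEquality using (_≡_)

open import Algebra.Bundles using (AbelianGroup; Ring)
import Algebra.Properties.AbelianGroup as AbelianGroupProperties
import Algebra.Properties.Ring as RingProperties
open import Algebra.Structures using (IsCommutativeRing)
open import Data.Bool using (Bool; true; false; _∧_; _∨_; not; if_then_else_; T)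
open import Data.Bool.ListAction using (all; any)
open import Data.Bool.Properties using (T?; T-∧; T-≡; T-not-≡)
open import Data.Empty using (⊥-elim)
open import Data.Fin using (Fin)
import Data.Fin.Properties as Fin
open import Data.Integer using (ℤ; +_) renaming (_+_ to _+ℤ_; -_ to negℤ)
import Data.Integer.Properties as ℤ
open import Data.List
  using (List; []; _∷_; _++_; map; filterᵇ; length; foldr; allFin; upTo; cartesianProductWith; concatMap)
open import Data.List.Membership.Propositional using (_∈_; lose; find)
open import Data.List.Membership.Propositional.Properties
  using (∈-filter⁻; ∈-filter⁺; ∈-map⁺; ∈-map⁻; ∈-++⁺ˡ; ∈-++⁺ʳ; ∈-++⁻; ∈-allFin; ∈-upTo⁺;
         ∈-cartesianProductWith⁺; ∈-cartesianProductWith⁻)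
open import Data.List.Properties
  using (∷-injectiveʳ; foldr-preservesᵇ; foldr-preservesᵒ; filter-notAll; filter-accept; filter-reject;
         length-filter)
open import Data.List.Relation.Binary.Disjoint.Propositional using (Disjoint)
open import Data.List.Relation.Unary.All as All using (All; [])
import Data.List.Relation.Unary.All.Properties as All
open import Data.List.Relation.Unary.AllPairs using ([]; _∷_)
open import Data.List.Relation.Unary.Any as Any using (Any; here; there)
import Data.List.Relation.Unary.Any.Properties as Any
open import Data.List.Relation.Unary.Unique.Propositional using (Unique)
import Data.List.Relation.Unary.Unique.Propositional.Properties as Unique
open import Data.Nat using (zero; suc; _<_; _≤_; _⊔_; _∸_; _≡ᵇ_; s≤s; z≤n)
open import Data.Nat.Properties using (≤-refl; ≤-trans; ≤-antisym; ⊔-lub; m≤m⊔n; m≤n⊔m; ≡ᵇ⇒≡)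
open import Data.Product using (∃; _×_; _,_; proj₁; proj₂)
open import Data.Sum using (_⊎_; inj₁; inj₂; [_,_])
open import Data.Vec using (Vec; []; _∷_)
import Data.Vec.Properties as Vec
import Data.Vec.Relation.Unary.All as VecAll
open import Function using (_∘_; _⇔_; Equivalence)
open import Relation.Binary.Definitions using (DecidableEquality)
open import Relation.Binary.PropositionalEquality
  using (_≢_; _≗_; refl; sym; trans; cong; cong₂; subst; module ≡-Reasoning)
open import Relation.Nullary using (¬_; does; yes; no)
open import Relation.Nullary.Decidable using (_×-dec_; ¬?)
open import Algebra.Properties.CommutativeSemigroup ℤ.+-commutativeSemigroup using (interchange)
open import Algebra.Properties.AbelianGroup ℤ.+-0-abelianGroup using (inverseˡ-unique)

open Equivalence using (to; from)

T-extensional : ∀ {a b} → (T a → T b) → (T b → T a) → a ≡ b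
T-extensional {false} {false} _ _ = refl
T-extensional {false} {true}  _ g = ⊥-elim (g _)
T-extensional {true}  {false} f _ = ⊥-elim (f _)
T-extensional {true}  {true}  _ _ = refl

T-not⁺ : ∀ {a} → ¬ T a → T (not a)
T-not⁺ {false} _  = _
T-not⁺ {true}  ¬a = ¬a _

T-not∨⁻ : ∀ {a b} → T (not a ∨ b) → T a → T b
T-not∨⁻ {true} t _ = t

T-not∨⁺ : ∀ {a b} → (T a → T b) → T (not a ∨ b)
T-not∨⁺ {false} _ = _
T-not∨⁺ {true}  f = f _

module _ {A : Set} where

  T-all⁻ : ∀ (p : A → Bool) xs → T (all p xs) → ∀ {x} → x ∈ xs → T (p x)
  T-all⁻ p xs t = All.lookup (All.all⁺ p xs t)

  T-all⁺ : ∀ (p : A → Bool) xs → (∀ {x} → x ∈ xs → T (p x)) → T (all p xs)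
  T-all⁺ p xs f = All.all⁻ p {xs} (All.tabulate f)

when : Bool → ℤ → ℤ
when b x = if b then x else + 0

when-∧ : ∀ a b x → when a (when b x) ≡ when (a ∧ b) x
when-∧ true  b x = refl
when-∧ false b x = refl

when-comm : ∀ a b x → when a (when b x) ≡ when b (when a x)
when-comm true  b     x = refl
when-comm false true  x = refl
when-comm false false x = refl

∑ : ∀ {A : Set} → List A → (A → ℤ) → ℤ
∑ xs f = sumℤ (map f xs)

module _ {A : Set} where

  ∑-cong : ∀ xs {f g : A → ℤ} → (∀ {x} → x ∈ xs → f x ≡ g x) → ∑ xs f ≡ ∑ xs g
  ∑-cong []       _   = refl
  ∑-cong (x ∷ xs) f≡g = cong₂ _+ℤ_ (f≡g (here refl)) (∑-cong xs (f≡g ∘ there))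

  ∑-zero : ∀ xs {f : A → ℤ} → (∀ {x} → x ∈ xs → f x ≡ + 0) → ∑ xs f ≡ + 0
  ∑-zero []       _   = refl
  ∑-zero (x ∷ xs) f≡0 = cong₂ _+ℤ_ (f≡0 (here refl)) (∑-zero xs (f≡0 ∘ there))

  ∑-++ : ∀ xs ys (f : A → ℤ) → ∑ (xs ++ ys) f ≡ ∑ xs f +ℤ ∑ ys f
  ∑-++ []       ys f = sym (ℤ.+-identityˡ _)
  ∑-++ (x ∷ xs) ys f = trans (cong (f x +ℤ_) (∑-++ xs ys f)) (sym (ℤ.+-assoc (f x) _ _))

  ∑-map : ∀ {B : Set} (g : B → A) xs (f : A → ℤ) → ∑ (map g xs) f ≡ ∑ xs (f ∘ g)
  ∑-map g []       f = refl
  ∑-map g (x ∷ xs) f = cong (f (g x) +ℤ_) (∑-map g xs f)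

  ∑-neg : ∀ xs (f : A → ℤ) → ∑ xs (negℤ ∘ f) ≡ negℤ (∑ xs f)
  ∑-neg []       f = refl
  ∑-neg (x ∷ xs) f = trans (cong (negℤ (f x) +ℤ_) (∑-neg xs f)) (sym (ℤ.neg-distrib-+ (f x) _))

  ∑-+ : ∀ xs (f g : A → ℤ) → ∑ xs (λ x → f x +ℤ g x) ≡ ∑ xs f +ℤ ∑ xs g
  ∑-+ []       f g = refl
  ∑-+ (x ∷ xs) f g = trans (cong (f x +ℤ g x +ℤ_) (∑-+ xs f g)) (interchange (f x) (g x) _ _)

  ∑-filterᵇ : ∀ (p : A → Bool) xs (f : A → ℤ) → ∑ (filterᵇ p xs) f ≡ ∑ xs (λ x → when (p x) (f x))
  ∑-filterᵇ p []       f = refl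
  ∑-filterᵇ p (x ∷ xs) f with p x
  ... | true  = cong (f x +ℤ_) (∑-filterᵇ p xs f)
  ... | false = trans (∑-filterᵇ p xs f) (sym (ℤ.+-identityˡ _))

  ∑-when : ∀ xs c (f : A → ℤ) → ∑ xs (λ x → when c (f x)) ≡ when c (∑ xs f)
  ∑-when xs true  f = refl
  ∑-when xs false f = ∑-zero xs (λ _ → refl)

  ∑-when-unique : ∀ {xs} {x₀ : A} (c : A → Bool) (f : A → ℤ) → Unique xs → x₀ ∈ xs → T (c x₀) →
                  (∀ {x} → x ∈ xs → T (c x) → x ≡ x₀) → ∑ xs (λ x → when (c x) (f x)) ≡ f x₀
  ∑-when-unique {y ∷ ys} c f (y∉ys ∷ _) (here refl) cy only
    rewrite to T-≡ cy = trans (cong (f y +ℤ_) (∑-zero ys others)) (ℤ.+-identityʳ (f y))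
    where
      others : ∀ {x} → x ∈ ys → when (c x) (f x) ≡ + 0
      others {x} x∈ys with c x in cx
      ... | false = refl
      ... | true  = ⊥-elim (All.lookup y∉ys x∈ys (sym (only (there x∈ys) (from T-≡ cx))))
  ∑-when-unique {y ∷ ys} c f (y∉ys ∷ u) (there x₀∈ys) cx₀ only with c y in cy
  ... | true  = ⊥-elim (All.lookup y∉ys x₀∈ys (only (here refl) (from T-≡ cy)))
  ... | false = trans (ℤ.+-identityˡ _) (∑-when-unique c f u x₀∈ys cx₀ (only ∘ there))

∑-swap : ∀ {A B : Set} (xs : List A) (ys : List B) (h : A → B → ℤ) →
         ∑ xs (λ x → ∑ ys (h x)) ≡ ∑ ys (λ y → ∑ xs (λ x → h x y))
∑-swap []       ys h = sym (∑-zero ys (λ _ → refl))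
∑-swap (x ∷ xs) ys h =
  trans (cong (∑ ys (h x) +ℤ_) (∑-swap xs ys h)) (sym (∑-+ ys (h x) (λ y → ∑ xs (λ x → h x y))))

module _ {A : Set} where

  filterᵇ-cong : ∀ {p q : A → Bool} {xs} → (∀ {x} → x ∈ xs → p x ≡ q x) → filterᵇ p xs ≡ filterᵇ q xs
  filterᵇ-cong {xs = []}               _   = refl
  filterᵇ-cong {p} {q} {xs = x ∷ xs} p≡q with p x | q x | p≡q (here refl)
  ... | true  | true  | refl = cong (x ∷_) (filterᵇ-cong (p≡q ∘ there))
  ... | false | false | refl = filterᵇ-cong (p≡q ∘ there)

  filterᵇ-absorb : ∀ {p q : A → Bool} {xs} → (∀ {x} → x ∈ xs → T (p x) → T (q x)) →
                   filterᵇ p (filterᵇ q xs) ≡ filterᵇ p xs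
  filterᵇ-absorb {xs = []}               _   = refl
  filterᵇ-absorb {p} {q} {xs = x ∷ xs} p⇒q with q x in qx | p x in px
  ... | true  | true  rewrite px = cong (x ∷_) (filterᵇ-absorb (p⇒q ∘ there))
  ... | true  | false rewrite px = filterᵇ-absorb (p⇒q ∘ there)
  ... | false | false = filterᵇ-absorb (p⇒q ∘ there)
  ... | false | true  = ⊥-elim (subst T qx (p⇒q (here refl) (from T-≡ px)))

  length-filterᵇ-< : ∀ {p q : A → Bool} {xs} {w} → (∀ {x} → x ∈ xs → T (p x) → T (q x)) →
                     w ∈ xs → T (q w) → ¬ T (p w) → length (filterᵇ p xs) < length (filterᵇ q xs)
  length-filterᵇ-< {p} {q} {xs} p⇒q w∈xs qw ¬pw =
    subst (λ ys → length ys < length (filterᵇ q xs)) (filterᵇ-absorb p⇒q)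
      (filter-notAll (T? ∘ p) (filterᵇ q xs) (lose (∈-filter⁺ (T? ∘ q) w∈xs qw) ¬pw))

  sublists-⊆ : ∀ xs {L} {x : A} → L ∈ sublists xs → x ∈ L → x ∈ xs
  sublists-⊆ [] (here refl) ()
  sublists-⊆ (y ∷ ys) L∈ x∈L with ∈-++⁻ (map (y ∷_) (sublists ys)) L∈
  ... | inj₂ L∈ys = there (sublists-⊆ ys L∈ys x∈L)
  ... | inj₁ yL∈ with ∈-map⁻ (y ∷_) yL∈
  ...   | L , L∈ys , refl with x∈L
  ...     | here refl  = here refl
  ...     | there x∈L′ = there (sublists-⊆ ys L∈ys x∈L′)

  filterᵇ∈sublists : ∀ (p : A → Bool) xs → filterᵇ p xs ∈ sublists xs
  filterᵇ∈sublists p []       = here refl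
  filterᵇ∈sublists p (x ∷ xs) with p x
  ... | true  = ∈-++⁺ˡ (∈-map⁺ (x ∷_) (filterᵇ∈sublists p xs))
  ... | false = ∈-++⁺ʳ (map (x ∷_) (sublists xs)) (filterᵇ∈sublists p xs)

  sublists-unique : ∀ {xs : List A} → Unique xs → Unique (sublists xs)
  sublists-unique {[]}     _            = [] ∷ []
  sublists-unique {x ∷ xs} u@(_ ∷ uxs) =
    Unique.++⁺ (Unique.map⁺ ∷-injectiveʳ (sublists-unique uxs)) (sublists-unique uxs) disjoint
    where
      disjoint : Disjoint (map (x ∷_) (sublists xs)) (sublists xs)
      disjoint (xL∈ , xL∈xs) with ∈-map⁻ (x ∷_) xL∈
      ... | _ , _ , refl = Unique.Unique[x∷xs]⇒x∉xs u (sublists-⊆ xs xL∈xs (here refl))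

  sgn : List A → ℤ
  sgn L = sign (length L)

  ∑-sgn-sublists-all : ∀ (p : A → Bool) xs →
    ∑ (sublists xs) (λ L → when (all p L) (sgn L)) ≡ when (not (any p xs)) (+ 1)
  ∑-sgn-sublists-all p []       = refl
  ∑-sgn-sublists-all p (x ∷ xs) =
    begin
      ∑ (map (x ∷_) (sublists xs) ++ sublists xs) G
        ≡⟨ ∑-++ (map (x ∷_) (sublists xs)) _ G ⟩
      ∑ (map (x ∷_) (sublists xs)) G +ℤ ∑ (sublists xs) G
        ≡⟨ cong (_+ℤ ∑ (sublists xs) G) (∑-map (x ∷_) (sublists xs) G) ⟩
      ∑ (sublists xs) (G ∘ (x ∷_)) +ℤ ∑ (sublists xs) G
        ≡⟨ by-head (p x) refl ⟩
      when (not (p x ∨ any p xs)) (+ 1) ∎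
    where
      open ≡-Reasoning
      G : List A → ℤ
      G L = when (all p L) (sgn L)
      by-head : ∀ b → p x ≡ b →
                ∑ (sublists xs) (G ∘ (x ∷_)) +ℤ ∑ (sublists xs) G ≡ when (not (b ∨ any p xs)) (+ 1)
      by-head true px =
        trans (cong (_+ℤ ∑ (sublists xs) G) (trans (∑-cong (sublists xs) flip) (∑-neg (sublists xs) G)))
              (ℤ.+-inverseˡ (∑ (sublists xs) G))
        where
          flip : ∀ {L} → L ∈ sublists xs → G (x ∷ L) ≡ negℤ (G L)
          flip {L} _ rewrite px with all p L
          ... | true  = refl
          ... | false = refl
      by-head false px =
        trans (cong (_+ℤ ∑ (sublists xs) G) (∑-zero (sublists xs) (λ {L} _ → vanish {L})))
              (trans (ℤ.+-identityˡ _) (∑-sgn-sublists-all p xs))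
        where
          vanish : ∀ {L} → G (x ∷ L) ≡ + 0
          vanish rewrite px = refl

module DecidableSublists {A : Set} (_≟_ : DecidableEquality A) where

  _∈ᵇ_ : A → List A → Bool
  a ∈ᵇ L = any (λ b → does (a ≟ b)) L

  ∈ᵇ⇒∈ : ∀ {a L} → T (a ∈ᵇ L) → a ∈ L
  ∈ᵇ⇒∈ {a} {x ∷ L} t with a ≟ x
  ... | yes refl = here refl
  ... | no  _    = there (∈ᵇ⇒∈ t)

  ∈⇒∈ᵇ : ∀ {a L} → a ∈ L → T (a ∈ᵇ L)
  ∈⇒∈ᵇ {a} {x ∷ L} a∈L with a ≟ x | a∈L
  ... | yes _   | _          = _
  ... | no  a≢x | here a≡x   = ⊥-elim (a≢x a≡x)
  ... | no  _   | there a∈L′ = ∈⇒∈ᵇ a∈L′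

  ∈ᵇ-∷-≢ : ∀ {a x} L → a ≢ x → a ∈ᵇ (x ∷ L) ≡ a ∈ᵇ L
  ∈ᵇ-∷-≢ {a} {x} L a≢x with a ≟ x
  ... | yes a≡x = ⊥-elim (a≢x a≡x)
  ... | no  _   = refl

  sublist≡filterᵇ : ∀ {xs L} → Unique xs → L ∈ sublists xs → L ≡ filterᵇ (_∈ᵇ L) xs
  sublist≡filterᵇ {[]} _ (here refl) = refl
  sublist≡filterᵇ {x ∷ xs} {L} u@(x∉xs ∷ uxs) L∈ with ∈-++⁻ (map (x ∷_) (sublists xs)) L∈
  ... | inj₂ L∈xs =
    trans (sublist≡filterᵇ uxs L∈xs) (sym (filter-reject (T? ∘ (_∈ᵇ L)) x∉L))
    where
      x∉L : ¬ T (x ∈ᵇ L)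
      x∉L = Unique.Unique[x∷xs]⇒x∉xs u ∘ sublists-⊆ xs L∈xs ∘ ∈ᵇ⇒∈
  ... | inj₁ xL∈ with ∈-map⁻ (x ∷_) xL∈
  ...   | L′ , L′∈xs , refl =
    begin
      x ∷ L′
        ≡⟨ cong (x ∷_) (sublist≡filterᵇ uxs L′∈xs) ⟩
      x ∷ filterᵇ (_∈ᵇ L′) xs
        ≡⟨ cong (x ∷_) (filterᵇ-cong (λ v∈xs → sym (∈ᵇ-∷-≢ L′ (≢x v∈xs)))) ⟩
      x ∷ filterᵇ (_∈ᵇ (x ∷ L′)) xs
        ≡⟨ sym (filter-accept (T? ∘ (_∈ᵇ (x ∷ L′))) (∈⇒∈ᵇ {L = x ∷ L′} (here refl))) ⟩
      filterᵇ (_∈ᵇ (x ∷ L′)) (x ∷ xs) ∎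
    where
      open ≡-Reasoning
      ≢x : ∀ {v} → v ∈ xs → v ≢ x
      ≢x v∈xs v≡x = All.lookup x∉xs v∈xs (sym v≡x)

module _ {A : Set} where

  tuples-suc : ∀ (xs : List A) k → tuples xs (suc k) ≡ cartesianProductWith _∷_ xs (tuples xs k)
  tuples-suc xs k = go xs
    where
      go : ∀ ys → concatMap (λ y → map (y ∷_) (tuples xs k)) ys ≡ cartesianProductWith _∷_ ys (tuples xs k)
      go []       = refl
      go (y ∷ ys) = cong (map (y ∷_) (tuples xs k) ++_) (go ys)

  ∈-tuples⁺ : ∀ {xs : List A} {k} {v : Vec A k} → VecAll.All (_∈ xs) v → v ∈ tuples xs k
  ∈-tuples⁺ VecAll.[] = here refl
  ∈-tuples⁺ {xs} {suc k} {x ∷ v} (x∈ VecAll.∷ v∈) =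
    subst ((x ∷ v) ∈_) (sym (tuples-suc xs k)) (∈-cartesianProductWith⁺ _∷_ x∈ (∈-tuples⁺ v∈))

  ∈-tuples-∷⁻ : ∀ {xs : List A} {k x} {v : Vec A k} →
                (x ∷ v) ∈ tuples xs (suc k) → x ∈ xs × v ∈ tuples xs k
  ∈-tuples-∷⁻ {xs} {k} x∷v∈
    with _ , _ , x∈ , v∈ , eq ← ∈-cartesianProductWith⁻ _∷_ xs (tuples xs k)
                                  (subst (_ ∈_) (tuples-suc xs k) x∷v∈)
    with refl , refl ← Vec.∷-injective eq = x∈ , v∈

  tuples-unique : ∀ {xs : List A} k → Unique xs → Unique (tuples xs k)
  tuples-unique zero    _ = [] ∷ []
  tuples-unique {xs} (suc k) u = subst Unique (sym (tuples-suc xs k))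
    (Unique.cartesianProductWith⁺ _∷_ Vec.∷-injective u (tuples-unique k u))

foldr-⊔-≡ : ∀ {d} xs → All (_≤ d) xs → Any (d ≤_) xs → foldr _⊔_ 0 xs ≡ d
foldr-⊔-≡ xs all≤ any≥ = ≤-antisym
  (foldr-preservesᵇ ⊔-lub z≤n all≤)
  (foldr-preservesᵒ (λ x y → [ (λ d≤x → ≤-trans d≤x (m≤m⊔n x y)) , (λ d≤y → ≤-trans d≤y (m≤n⊔m x y)) ])
                     0 xs (inj₂ any≥))

-- Möbius functions

-- μ x is determined by its interval sums: a g with ∑_{x ≤ z ≤ y} g z = δ(x, y) agrees with μ x.
-- The induction follows the fuel recursion of μ, with the number of elements below y as measure.
module MöbiusCharacterisation {A : Set} (elems : List A) (_≤?_ _==_ : A → A → Bool)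
  (≤?-refl  : ∀ x → T (x ≤? x))
  (≤?-trans : ∀ {x y z} → T (x ≤? y) → T (y ≤? z) → T (x ≤? z))
  (==⇔≤≥   : ∀ {x y} → T (x == y) ⇔ (T (x ≤? y) × T (y ≤? x)))
  where

  open Möbius elems _≤?_ _==_

  height : A → ℕ
  height y = length (filterᵇ (_≤? y) elems)

  module _ (x : A) (g : A → ℤ)
    (∑-== : ∀ {y} → y ∈ elems → ∑ elems (λ z → when (z == y) (g z)) ≡ g y)
    (∑-interval : ∀ {y} → y ∈ elems → T (x ≤? y) →
                  ∑ elems (λ z → when ((x ≤? z) ∧ (z ≤? y)) (g z)) ≡ when (x == y) (+ 1))
    where

    strictly-below : A → A → Bool
    strictly-below y z = (x ≤? z) ∧ (z ≤? y) ∧ not (z == y)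

    when-interval-split : ∀ {y} → T (x ≤? y) → ∀ z →
      when ((x ≤? z) ∧ (z ≤? y)) (g z) ≡ when (z == y) (g z) +ℤ when (strictly-below y z) (g z)
    when-interval-split {y} x≤y z with z == y in z==y
    ... | true  rewrite to T-≡ (≤?-trans x≤y (proj₂ (to ==⇔≤≥ (from T-≡ z==y))))
                      | to T-≡ (proj₁ (to ==⇔≤≥ (from T-≡ z==y))) = sym (ℤ.+-identityʳ (g z))
    ... | false with x ≤? z | z ≤? y
    ...   | true  | true  = sym (ℤ.+-identityˡ (g z))
    ...   | true  | false = refl
    ...   | false | _     = refl

    height-< : ∀ {y z} → y ∈ elems → T (strictly-below y z) → height z < height y
    height-< {y} {z} y∈elems below =
      length-filterᵇ-< (λ _ w≤z → ≤?-trans w≤z z≤y) y∈elems (≤?-refl y)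
                       (λ y≤z → subst T (to T-not-≡ z≢y) (from ==⇔≤≥ (z≤y , y≤z)))
      where
        z≤y×z≢y : T (z ≤? y) × T (not (z == y))
        z≤y×z≢y = to (T-∧ {z ≤? y}) (proj₂ (to (T-∧ {x ≤? z}) below))
        z≤y = proj₁ z≤y×z≢y
        z≢y = proj₂ z≤y×z≢y

    interval≡== : ∀ {y} → T (x == y) → ∀ z → (x ≤? z) ∧ (z ≤? y) ≡ z == y
    interval≡== {y} x==y z = T-extensional
      (λ t → let x≤z , z≤y = to (T-∧ {x ≤? z}) t in from ==⇔≤≥ (z≤y , ≤?-trans y≤x x≤z))
      (λ t → let z≤y , y≤z = to ==⇔≤≥ t in from T-∧ (≤?-trans x≤y y≤z , z≤y))
      where
        x≤y = proj₁ (to ==⇔≤≥ x==y)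
        y≤x = proj₂ (to ==⇔≤≥ x==y)

    ∑-interval-at : ∀ {y} → y ∈ elems → T (x ≤? y) → ∀ {b} → x == y ≡ b →
                  ∑ elems (λ z → when ((x ≤? z) ∧ (z ≤? y)) (g z)) ≡ when b (+ 1)
    ∑-interval-at y∈elems x≤y x==y = trans (∑-interval y∈elems x≤y) (cong (λ b → when b (+ 1)) x==y)

    μ-fuel≡ : ∀ k {y} → y ∈ elems → T (x ≤? y) → height y < k → μ-fuel k x y ≡ g y
    μ-fuel≡ (suc k) {y} y∈elems x≤y (s≤s hy≤k) with x == y in x==y
    ... | true =
      begin
        + 1
          ≡⟨ sym (∑-interval-at y∈elems x≤y x==y) ⟩
        ∑ elems (λ z → when ((x ≤? z) ∧ (z ≤? y)) (g z))
          ≡⟨ ∑-cong elems (λ {z} _ → cong (λ b → when b (g z)) (interval≡== (from T-≡ x==y) z)) ⟩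
        ∑ elems (λ z → when (z == y) (g z))
          ≡⟨ ∑-== y∈elems ⟩
        g y ∎
      where open ≡-Reasoning
    ... | false rewrite to T-≡ x≤y =
      sym (inverseˡ-unique (g y) (∑ (filterᵇ (strictly-below y) elems) (μ-fuel k x)) (begin
        g y +ℤ ∑ (filterᵇ (strictly-below y) elems) (μ-fuel k x)
          ≡⟨ cong₂ _+ℤ_ (sym (∑-== y∈elems))
                        (trans (∑-cong _ below≡) (∑-filterᵇ (strictly-below y) elems g)) ⟩
        ∑ elems (λ z → when (z == y) (g z)) +ℤ ∑ elems (λ z → when (strictly-below y z) (g z))
          ≡⟨ sym (∑-+ elems _ _) ⟩
        ∑ elems (λ z → when (z == y) (g z) +ℤ when (strictly-below y z) (g z))
          ≡⟨ sym (∑-cong elems (λ {z} _ → when-interval-split x≤y z)) ⟩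
        ∑ elems (λ z → when ((x ≤? z) ∧ (z ≤? y)) (g z))
          ≡⟨ ∑-interval-at y∈elems x≤y x==y ⟩
        + 0 ∎))
      where
        open ≡-Reasoning
        below≡ : ∀ {z} → z ∈ filterᵇ (strictly-below y) elems → μ-fuel k x z ≡ g z
        below≡ z∈ with z∈elems , below ← ∈-filter⁻ (T? ∘ strictly-below y) z∈ =
          μ-fuel≡ k z∈elems (proj₁ (to (T-∧ {x ≤? _}) below)) (≤-trans (height-< y∈elems below) hy≤k)

    μ≡ : ∀ {y} → y ∈ elems → T (x ≤? y) → μ x y ≡ g y
    μ≡ {y} y∈elems x≤y =
      μ-fuel≡ (suc (length elems)) y∈elems x≤y (s≤s (length-filter (T? ∘ (_≤? y)) elems))

module FieldProperties {q : ℕ} (F : FiniteField q) where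
  open FiniteField F
  open IsCommutativeRing isCommutativeRing public
    using (zeroˡ; *-identityˡ; *-identityʳ; distribʳ; *-assoc; *-comm; +-identityʳ; -‿inverseʳ)
  open IsCommutativeRing isCommutativeRing using (+-isAbelianGroup; isRing)

  +-abelianGroup : AbelianGroup _ _
  +-abelianGroup = record { isAbelianGroup = +-isAbelianGroup }

  ring : Ring _ _
  ring = record { isRing = isRing }

  open AbelianGroupProperties +-abelianGroup using (⁻¹-injective; ε⁻¹≈ε)
  open RingProperties ring public using (-‿distribˡ-*)

  *-cancelʳ-0 : ∀ c x → x ≢ 0# → c * x ≡ 0# → c ≡ 0#
  *-cancelʳ-0 c x x≢0 cx≡0 with y , xy≡1 ← inverse x x≢0 =
    begin
      c           ≡⟨ sym (*-identityʳ c) ⟩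
      c * 1#      ≡⟨ cong (c *_) (sym xy≡1) ⟩
      c * (x * y) ≡⟨ sym (*-assoc c x y) ⟩
      (c * x) * y ≡⟨ cong (_* y) cx≡0 ⟩
      0# * y      ≡⟨ zeroˡ y ⟩
      0#          ∎
    where open ≡-Reasoning

  -‿≢0 : ∀ {a} → a ≢ 0# → - a ≢ 0#
  -‿≢0 a≢0 -a≡0 = a≢0 (⁻¹-injective (trans -a≡0 (sym ε⁻¹≈ε)))

-- Subspaces, spans and lines of E = F_q^n

module Geometry {q : ℕ} (F : FiniteField q) (n : ℕ) where
  open FiniteField F
  open FieldProperties F
  open Space F n

  =ᵛ⇒≡ : ∀ {m} {u v : Vec (Fin q) m} → T (u =ᵛ v) → u ≡ v
  =ᵛ⇒≡ {u = u} {v} t with Vec.≡-dec Fin._≟_ u v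
  ... | yes u≡v = u≡v

  ≡⇒=ᵛ : ∀ {m} {u v : Vec (Fin q) m} → u ≡ v → T (u =ᵛ v)
  ≡⇒=ᵛ {u = u} {v} u≡v with Vec.≡-dec Fin._≟_ u v
  ... | yes _   = _
  ... | no  u≢v = u≢v u≡v

  ·-zeroˡ : ∀ {m} (v : Vec (Fin q) m) → 0# · v ≡ zeroV
  ·-zeroˡ []      = refl
  ·-zeroˡ (x ∷ v) = cong₂ _∷_ (zeroˡ x) (·-zeroˡ v)

  ·-identityˡ : ∀ {m} (v : Vec (Fin q) m) → 1# · v ≡ v
  ·-identityˡ []      = refl
  ·-identityˡ (x ∷ v) = cong₂ _∷_ (*-identityˡ x) (·-identityˡ v)

  ⊕-identityʳ : ∀ {m} (v : Vec (Fin q) m) → v ⊕ zeroV ≡ v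
  ⊕-identityʳ []      = refl
  ⊕-identityʳ (x ∷ v) = cong₂ _∷_ (+-identityʳ x) (⊕-identityʳ v)

  ·-distribʳ : ∀ {m} c d (v : Vec (Fin q) m) → (c · v) ⊕ (d · v) ≡ (c + d) · v
  ·-distribʳ c d []      = refl
  ·-distribʳ c d (x ∷ v) = cong₂ _∷_ (sym (distribʳ x c d)) (·-distribʳ c d v)

  ·-assoc : ∀ {m} c d (v : Vec (Fin q) m) → c · (d · v) ≡ (c * d) · v
  ·-assoc c d []      = refl
  ·-assoc c d (x ∷ v) = cong₂ _∷_ (sym (*-assoc c d x)) (·-assoc c d v)

  ·-cancelʳ-0 : ∀ {m} c (v : Vec (Fin q) m) → v ≢ zeroV → c · v ≡ zeroV → c ≡ 0#
  ·-cancelʳ-0 c []      v≢0 _    = ⊥-elim (v≢0 refl)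
  ·-cancelʳ-0 c (x ∷ v) v≢0 cv≡0 with x Fin.≟ 0#
  ... | no  x≢0  = *-cancelʳ-0 c x x≢0 (Vec.∷-injectiveˡ cv≡0)
  ... | yes refl = ·-cancelʳ-0 c v (v≢0 ∘ cong (0# ∷_)) (Vec.∷-injectiveʳ cv≡0)

  lincomb-zeroˡ : ∀ {k} (vs : Vec Vector k) → lincomb zeroV vs ≡ zeroV
  lincomb-zeroˡ []       = refl
  lincomb-zeroˡ (v ∷ vs) rewrite lincomb-zeroˡ vs | ·-zeroˡ v = ⊕-identityʳ zeroV

  nonzero⇒1≤length : ∀ {m} {v : Vec (Fin q) m} → v ≢ zeroV → 1 ≤ m
  nonzero⇒1≤length {zero}  {[]} v≢0 = ⊥-elim (v≢0 refl)
  nonzero⇒1≤length {suc m} _        = s≤s z≤n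

  _≟ᵛ_ : DecidableEquality Vector
  _≟ᵛ_ = Vec.≡-dec Fin._≟_

  ∈-allVecs : ∀ {m} (v : Vec (Fin q) m) → v ∈ allVecs m
  ∈-allVecs v = ∈-tuples⁺ (VecAll.universal ∈-allFin v)

  ∈-allE : ∀ (v : Vector) → v ∈ allE
  ∈-allE = ∈-allVecs

  allE-unique : Unique allE
  allE-unique = tuples-unique n (Unique.allFin⁺ q)

  T-allE⁻ : ∀ (p : Vector → Bool) → T (all p allE) → ∀ v → T (p v)
  T-allE⁻ p t v = T-all⁻ p allE t (∈-allE v)

  T-allE⁺ : ∀ (p : Vector → Bool) → (∀ v → T (p v)) → T (all p allE)
  T-allE⁺ p f = T-all⁺ p allE (λ {v} _ → f v)

  ⊆⁻ : ∀ V W → V ⊆ W → ∀ {v} → T (V v) → T (W v)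
  ⊆⁻ V W V⊆W {v} = T-not∨⁻ (T-allE⁻ (λ u → not (V u) ∨ W u) V⊆W v)

  ⊆⁺ : ∀ V W → (∀ {v} → T (V v) → T (W v)) → V ⊆ W
  ⊆⁺ V W V⊆W = T-allE⁺ (λ u → not (V u) ∨ W u) (λ _ → T-not∨⁺ V⊆W)

  ⊆-refl : ∀ V → V ⊆ V
  ⊆-refl V = ⊆⁺ V V (λ t → t)

  ⊆-trans : ∀ U V W → U ⊆ V → V ⊆ W → U ⊆ W
  ⊆-trans U V W U⊆V V⊆W = ⊆⁺ U W (⊆⁻ V W V⊆W ∘ ⊆⁻ U V U⊆V)

  ==ˢ⇒≗ : ∀ V W → T (V ==ˢ W) → V ≗ W
  ==ˢ⇒≗ V W V==W v = let V⊆W , W⊆V = to (T-∧ {V ⊆? W}) V==W in T-extensional (⊆⁻ V W V⊆W) (⊆⁻ W V W⊆V)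

  ≗⇒==ˢ : ∀ V W → V ≗ W → T (V ==ˢ W)
  ≗⇒==ˢ V W V≗W = from T-∧ (⊆⁺ V W (λ {v} → subst T (V≗W v)) , ⊆⁺ W V (λ {v} → subst T (sym (V≗W v))))

  ⊆?-congˡ : ∀ {V W} X → V ≗ W → (V ⊆? X) ≡ (W ⊆? X)
  ⊆?-congˡ {V} {W} X V≗W =
    T-extensional (λ V⊆X → ⊆⁺ W X (λ {v} t → ⊆⁻ V X V⊆X (subst T (sym (V≗W v)) t)))
                  (λ W⊆X → ⊆⁺ V X (λ {v} t → ⊆⁻ W X W⊆X (subst T (V≗W v) t)))

  ==ˢ-congˡ : ∀ {V W} X → V ≗ W → (V ==ˢ X) ≡ (W ==ˢ X)
  ==ˢ-congˡ {V} {W} X V≗W =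
    T-extensional (λ V==X → ≗⇒==ˢ W X (λ v → trans (sym (V≗W v)) (==ˢ⇒≗ V X V==X v)))
                  (λ W==X → ≗⇒==ˢ V X (λ v → trans (V≗W v) (==ˢ⇒≗ W X W==X v)))

  record LinearlyClosed (V : SubsetE) : Set where
    field
      zero∈    : T (V zeroV)
      ⊕-closed : ∀ {u v} → T (V u) → T (V v) → T (V (u ⊕ v))
      ·-closed : ∀ c {v} → T (V v) → T (V (c · v))

  isSubspace⁻ : ∀ V → IsSubspace V → LinearlyClosed V
  isSubspace⁻ V isSub = record
    { zero∈    = zero∈
    ; ⊕-closed = λ {u} {v} Vu Vv → T-not∨⁻ (T-allE⁻ _ (T-allE⁻ _ ⊕-closed u) v) (from T-∧ (Vu , Vv))
    ; ·-closed = λ c {v} → T-not∨⁻ (T-allE⁻ _ (T-all⁻ _ (allFin q) ·-closed (∈-allFin c)) v)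
    }
    where
      ⊕-closedᵇ = all (λ u → all (λ v → not (V u ∧ V v) ∨ V (u ⊕ v)) allE) allE
      zero∈    = proj₁ (to (T-∧ {V zeroV}) isSub)
      ⊕-closed = proj₁ (to (T-∧ {⊕-closedᵇ}) (proj₂ (to (T-∧ {V zeroV}) isSub)))
      ·-closed = proj₂ (to (T-∧ {⊕-closedᵇ}) (proj₂ (to (T-∧ {V zeroV}) isSub)))

  isSubspace⁺ : ∀ V → LinearlyClosed V → IsSubspace V
  isSubspace⁺ V closed = from T-∧ (zero∈ , from T-∧ (⊕-closedᵇ , ·-closedᵇ))
    where
      open LinearlyClosed closed
      ⊕-closedᵇ = T-allE⁺ _ λ u → T-allE⁺ (λ v → not (V u ∧ V v) ∨ V (u ⊕ v)) λ _ →
                    T-not∨⁺ (λ t → let Vu , Vv = to (T-∧ {V u}) t in ⊕-closed Vu Vv)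
      ·-closedᵇ = T-all⁺ _ (allFin q) λ {c} _ → T-allE⁺ (λ v → not (V v) ∨ V (c · v)) λ _ →
                    T-not∨⁺ (·-closed c)

  isSubspace-resp-≗ : ∀ {V W} → V ≗ W → IsSubspace V → IsSubspace W
  isSubspace-resp-≗ {V} {W} V≗W isSubV = isSubspace⁺ W record
    { zero∈    = ⇒W zero∈
    ; ⊕-closed = λ Wu Wv → ⇒W (⊕-closed (⇐W Wu) (⇐W Wv))
    ; ·-closed = λ c Wv → ⇒W (·-closed c (⇐W Wv))
    }
    where
      open LinearlyClosed (isSubspace⁻ V isSubV)
      ⇒W : ∀ {v} → T (V v) → T (W v)
      ⇒W {v} = subst T (V≗W v)
      ⇐W : ∀ {v} → T (W v) → T (V v)
      ⇐W {v} = subst T (sym (V≗W v))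

  ∈subspaces⇒isSubspace : ∀ {V} → V ∈ subspaces → IsSubspace V
  ∈subspaces⇒isSubspace V∈ = proj₂ (∈-filter⁻ (T? ∘ isSubspace) {xs = map fromList (sublists allE)} V∈)

  ∈subspaces⇒linearlyClosed : ∀ {V} → V ∈ subspaces → LinearlyClosed V
  ∈subspaces⇒linearlyClosed {V} = isSubspace⁻ V ∘ ∈subspaces⇒isSubspace

  zeroSub⊆ : ∀ {V} → LinearlyClosed V → zeroSub ⊆ V
  zeroSub⊆ {V} closed = ⊆⁺ zeroSub V (λ u=0 → subst (T ∘ V) (sym (=ᵛ⇒≡ u=0)) (LinearlyClosed.zero∈ closed))

  open DecidableSublists _≟ᵛ_

  -- The members of subspaces are of the form fromList L; this one represents S.
  representative : SubsetE → SubsetE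
  representative S = fromList (filterᵇ S allE)

  representative≗ : ∀ S → representative S ≗ S
  representative≗ S v = T-extensional
    (λ t → proj₂ (∈-filter⁻ (T? ∘ S) {xs = allE} (∈ᵇ⇒∈ t)))
    (λ t → ∈⇒∈ᵇ (∈-filter⁺ (T? ∘ S) (∈-allE v) t))

  representative∈subspaces : ∀ {S} → IsSubspace S → representative S ∈ subspaces
  representative∈subspaces {S} isSubS =
    ∈-filter⁺ (T? ∘ isSubspace) (∈-map⁺ fromList (filterᵇ∈sublists S allE))
              (isSubspace-resp-≗ (sym ∘ representative≗ S) isSubS)

  ∑-subspaces-== : ∀ {S} (g : SubsetE → ℤ) → IsSubspace S → (∀ {V W} → V ≗ W → g V ≡ g W) →
                   ∑ subspaces (λ V → when (V ==ˢ S) (g V)) ≡ g S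
  ∑-subspaces-== {S} g isSubS g-resp =
    begin
      ∑ subspaces (λ V → when (V ==ˢ S) (g V))
        ≡⟨ ∑-filterᵇ isSubspace (map fromList (sublists allE)) _ ⟩
      ∑ (map fromList (sublists allE)) (λ V → when (isSubspace V) (when (V ==ˢ S) (g V)))
        ≡⟨ ∑-map fromList (sublists allE) _ ⟩
      ∑ (sublists allE) (λ L → when (isSubspace (fromList L)) (when (fromList L ==ˢ S) (g (fromList L))))
        ≡⟨ ∑-cong (sublists allE) (λ {L} _ → when-∧ (isSubspace (fromList L)) _ _) ⟩
      ∑ (sublists allE) (λ L → when (represents L) (g (fromList L)))
        ≡⟨ ∑-when-unique represents (g ∘ fromList) (sublists-unique allE-unique)
                         (filterᵇ∈sublists S allE) represents-S only ⟩
      g (representative S)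
        ≡⟨ g-resp (representative≗ S) ⟩
      g S ∎
    where
      open ≡-Reasoning
      represents : List Vector → Bool
      represents L = isSubspace (fromList L) ∧ (fromList L ==ˢ S)
      represents-S : T (represents (filterᵇ S allE))
      represents-S = from T-∧ (isSubspace-resp-≗ (sym ∘ representative≗ S) isSubS ,
                               ≗⇒==ˢ (representative S) S (representative≗ S))
      only : ∀ {L} → L ∈ sublists allE → T (represents L) → L ≡ filterᵇ S allE
      only {L} L∈ rep = trans (sublist≡filterᵇ allE-unique L∈) (filterᵇ-cong {xs = allE} λ {v} _ →
        ==ˢ⇒≗ (fromList L) S (proj₂ (to (T-∧ {isSubspace (fromList L)}) rep)) v)

  span⁻ : ∀ S {v} → T (span S v) → ∀ {W} → W ∈ subspaces → S ⊆ W → T (W v)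
  span⁻ S {v} t = T-not∨⁻ ∘ T-all⁻ (λ W → not (S ⊆? W) ∨ W v) subspaces t

  span⁺ : ∀ S {v} → (∀ {W} → W ∈ subspaces → S ⊆ W → T (W v)) → T (span S v)
  span⁺ S {v} f = T-all⁺ (λ W → not (S ⊆? W) ∨ W v) subspaces (T-not∨⁺ ∘ f)

  ⊆span : ∀ S {v} → T (S v) → T (span S v)
  ⊆span S Sv = span⁺ S (λ {W} _ S⊆W → ⊆⁻ S W S⊆W Sv)

  span-isSubspace : ∀ S → IsSubspace (span S)
  span-isSubspace S = isSubspace⁺ (span S) record
    { zero∈    = span⁺ S (λ W∈ _ → zero∈ (closed W∈))
    ; ⊕-closed = λ tu tv → span⁺ S (λ W∈ S⊆W →
                   ⊕-closed (closed W∈) (span⁻ S tu W∈ S⊆W) (span⁻ S tv W∈ S⊆W))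
    ; ·-closed = λ c tv → span⁺ S (λ W∈ S⊆W → ·-closed (closed W∈) c (span⁻ S tv W∈ S⊆W))
    }
    where
      open LinearlyClosed
      closed = ∈subspaces⇒linearlyClosed

  union : List SubsetE → SubsetE
  union A v = any (λ L → L v) A

  ⟨⟩⊆?≡all⊆? : ∀ A {V} → V ∈ subspaces → (⟨ A ⟩ ⊆? V) ≡ all (_⊆? V) A
  ⟨⟩⊆?≡all⊆? A {V} V∈ = T-extensional
    (λ ⟨A⟩⊆V → T-all⁺ (_⊆? V) A λ {L} L∈A → ⊆⁺ L V λ {u} Lu →
      ⊆⁻ ⟨ A ⟩ V ⟨A⟩⊆V (⊆span (union A) (Any.any⁺ (λ L → L u) (lose L∈A Lu))))
    (λ all⊆ → ⊆⁺ ⟨ A ⟩ V λ t → span⁻ (union A) t V∈ (⊆⁺ (union A) V λ {u} Au →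
      All.lookupWith (λ {L} L⊆V Lu → ⊆⁻ L V L⊆V Lu)
                     (All.all⁺ (_⊆? V) A all⊆) (Any.any⁻ (λ L → L u) A Au)))

  independent⇒trivial : ∀ {k} {vs : Vec Vector k} → T (independent vs) →
                        ∀ c → lincomb c vs ≡ zeroV → c ≡ zeroV
  independent⇒trivial {k} {vs} ind c c·vs≡0 =
    =ᵛ⇒≡ (T-not∨⁻ (T-all⁻ (λ c → not (lincomb c vs =ᵛ zeroV) ∨ (c =ᵛ zeroV)) (allVecs k) ind (∈-allVecs c))
                  (≡⇒=ᵛ c·vs≡0))

  trivial⇒independent : ∀ {k} {vs : Vec Vector k} →
                        (∀ c → lincomb c vs ≡ zeroV → c ≡ zeroV) → T (independent vs)
  trivial⇒independent {k} {vs} trivial =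
    T-all⁺ (λ c → not (lincomb c vs =ᵛ zeroV) ∨ (c =ᵛ zeroV)) (allVecs k) λ {c} _ →
      T-not∨⁺ (≡⇒=ᵛ ∘ trivial c ∘ =ᵛ⇒≡)

  ¬independent-zero∷ : ∀ {k} (vs : Vec Vector k) → ¬ T (independent (zeroV ∷ vs))
  ¬independent-zero∷ vs ind = 0≢1 (sym (Vec.∷-injectiveˡ (independent⇒trivial ind (1# ∷ zeroV) relation)))
    where
      relation : (1# · zeroV) ⊕ lincomb zeroV vs ≡ zeroV
      relation rewrite ·-identityˡ (zeroV {n}) | lincomb-zeroˡ vs = ⊕-identityʳ zeroV

  -- For a ≠ 0 the coefficients (b, -a) give a nontrivial relation between a·v and b·v.
  ¬independent-parallel : ∀ {k} a b v (vs : Vec Vector k) → ¬ T (independent ((a · v) ∷ (b · v) ∷ vs))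
  ¬independent-parallel a b v vs with a Fin.≟ 0#
  ... | yes refl rewrite ·-zeroˡ v = ¬independent-zero∷ ((b · v) ∷ vs)
  ... | no  a≢0  = λ ind →
    -‿≢0 a≢0 (Vec.∷-injectiveˡ (Vec.∷-injectiveʳ (independent⇒trivial ind (b ∷ (- a) ∷ zeroV) relation)))
    where
      open ≡-Reasoning
      relation : lincomb (b ∷ (- a) ∷ zeroV) ((a · v) ∷ (b · v) ∷ vs) ≡ zeroV
      relation =
        begin
          (b · (a · v)) ⊕ (((- a) · (b · v)) ⊕ lincomb zeroV vs)
            ≡⟨ cong (λ w → (b · (a · v)) ⊕ (((- a) · (b · v)) ⊕ w)) (lincomb-zeroˡ vs) ⟩
          (b · (a · v)) ⊕ (((- a) · (b · v)) ⊕ zeroV)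
            ≡⟨ cong ((b · (a · v)) ⊕_) (⊕-identityʳ _) ⟩
          (b · (a · v)) ⊕ ((- a) · (b · v))
            ≡⟨ cong₂ _⊕_ (·-assoc b a v) (·-assoc (- a) b v) ⟩
          ((b * a) · v) ⊕ (((- a) * b) · v)
            ≡⟨ ·-distribʳ (b * a) ((- a) * b) v ⟩
          ((b * a) + ((- a) * b)) · v
            ≡⟨ cong (_· v) (trans (cong₂ _+_ (*-comm b a) (sym (-‿distribˡ-* a b))) (-‿inverseʳ (a * b))) ⟩
          0# · v
            ≡⟨ ·-zeroˡ v ⟩
          zeroV ∎

  independent-[nonzero] : ∀ {v} → v ≢ zeroV → T (independent (v ∷ []))
  independent-[nonzero] {v} v≢0 = trivial⇒independent {vs = v ∷ []} λ where
    (c ∷ []) c·v⊕0≡0 → cong (_∷ []) (·-cancelʳ-0 c v v≢0 (trans (sym (⊕-identityʳ (c · v))) c·v⊕0≡0))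

  -- dim V unfolds to rank (filterᵇ V allE).
  rank : List Vector → ℕ
  rank ys = foldr _⊔_ 0 (map (λ k → if any independent (tuples ys k) then k else 0) (upTo (suc n)))

  dim-cong : ∀ {V W} → V ≗ W → dim V ≡ dim W
  dim-cong V≗W = cong rank (filterᵇ-cong {xs = allE} (λ {v} _ → V≗W v))

  rank≡ : ∀ ys d → d ≤ n →
          (∀ {k} {vs : Vec Vector k} → vs ∈ tuples ys k → T (independent vs) → k ≤ d) →
          (d ≡ 0 ⊎ ∃ λ vs → vs ∈ tuples ys d × T (independent vs)) → rank ys ≡ d
  rank≡ ys d d≤n bounded attained =
    foldr-⊔-≡ _ (All.map⁺ (All.tabulate below)) (Any.map⁺ (lose (∈-upTo⁺ (s≤s d≤n)) (reached attained)))
    where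
      g : ℕ → ℕ
      g k = if any independent (tuples ys k) then k else 0
      below : ∀ {k} → k ∈ upTo (suc n) → g k ≤ d
      below {k} _ with any independent (tuples ys k) in has
      ... | true  = let _ , vs∈ , ind = find (Any.any⁻ independent _ (from T-≡ has)) in bounded vs∈ ind
      ... | false = z≤n
      reached : (d ≡ 0 ⊎ ∃ λ vs → vs ∈ tuples ys d × T (independent vs)) → d ≤ g d
      reached (inj₁ d≡0) = subst (_≤ g d) (sym d≡0) z≤n
      reached (inj₂ (_ , vs∈ , ind)) rewrite to T-≡ (Any.any⁺ independent (lose vs∈ ind)) = ≤-refl

  module LineThrough {v : Vector} (v≢0 : v ≢ zeroV) where

    multiples : SubsetE
    multiples u = any (λ c → u =ᵛ (c · v)) (allFin q)

    multiples⁻ : ∀ u → T (multiples u) → ∃ λ c → u ≡ c · v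
    multiples⁻ u t = let c , _ , u=cv = find (Any.any⁻ _ (allFin q) t) in c , =ᵛ⇒≡ u=cv

    multiples⁺ : ∀ {u} c → u ≡ c · v → T (multiples u)
    multiples⁺ c u≡cv = Any.any⁺ _ (lose (∈-allFin c) (≡⇒=ᵛ u≡cv))

    multiples-isSubspace : IsSubspace multiples
    multiples-isSubspace = isSubspace⁺ multiples record
      { zero∈    = multiples⁺ 0# (sym (·-zeroˡ v))
      ; ⊕-closed = λ {u} {w} tu tw → let a , u≡av = multiples⁻ u tu ; b , w≡bv = multiples⁻ w tw in
                   multiples⁺ (a + b) (trans (cong₂ _⊕_ u≡av w≡bv) (·-distribʳ a b v))
      ; ·-closed = λ c {u} tu → let a , u≡av = multiples⁻ u tu in
                   multiples⁺ (c * a) (trans (cong (c ·_) u≡av) (·-assoc c a v))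
      }

    dim-multiples : dim multiples ≡ 1
    dim-multiples = rank≡ ys 1 (nonzero⇒1≤length v≢0) bounded
                      (inj₂ (v ∷ [] , ∈-tuples⁺ (v∈ys VecAll.∷ VecAll.[]) , independent-[nonzero] v≢0))
      where
        ys = filterᵇ multiples allE
        v∈ys : v ∈ ys
        v∈ys = ∈-filter⁺ (T? ∘ multiples) (∈-allE v) (multiples⁺ 1# (sym (·-identityˡ v)))
        entry : ∀ {u} → u ∈ ys → ∃ λ c → u ≡ c · v
        entry u∈ = multiples⁻ _ (proj₂ (∈-filter⁻ (T? ∘ multiples) {xs = allE} u∈))
        bounded : ∀ {k} {vs : Vec Vector k} → vs ∈ tuples ys k → T (independent vs) → k ≤ 1
        bounded {zero}        _ _ = z≤n
        bounded {suc zero}    _ _ = s≤s z≤n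
        bounded {suc (suc k)} {u ∷ w ∷ vs} uwvs∈ ind
          with u∈ , wvs∈ ← ∈-tuples-∷⁻ uwvs∈
          with w∈ , _    ← ∈-tuples-∷⁻ wvs∈
          with a , refl  ← entry u∈
          with b , refl  ← entry w∈ = ⊥-elim (¬independent-parallel a b v vs ind)

    line : SubsetE
    line = representative multiples

    line∈lines : line ∈ lines
    line∈lines = ∈-filter⁺ (T? ∘ (λ L → dim L ≡ᵇ 1)) (representative∈subspaces multiples-isSubspace)
                   (subst (λ d → T (d ≡ᵇ 1)) (sym (trans (dim-cong (representative≗ multiples)) dim-multiples)) _)

    ∈line : T (line v)
    ∈line = subst T (sym (representative≗ multiples v)) (multiples⁺ 1# (sym (·-identityˡ v)))

    line⊆ : ∀ {W} → LinearlyClosed W → T (W v) → line ⊆ W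
    line⊆ {W} closed Wv = ⊆⁺ line W λ {u} t →
      let c , u≡cv = multiples⁻ u (subst T (representative≗ multiples u) t) in
      subst (T ∘ W) (sym u≡cv) (LinearlyClosed.·-closed closed c Wv)

  zero-or-nonzero : ∀ (V : SubsetE) → (∀ {u} → T (V u) → u ≡ zeroV) ⊎ (∃ λ u → T (V u) × u ≢ zeroV)
  zero-or-nonzero V with Any.any? (λ u → T? (V u) ×-dec ¬? (u ≟ᵛ zeroV)) allE
  ... | yes nonzero = let u , _ , Vu≢0 = find nonzero in inj₂ (u , Vu≢0)
  ... | no  ¬nonzero = inj₁ only-zero
    where
      only-zero : ∀ {u} → T (V u) → u ≡ zeroV
      only-zero {u} Vu with u ≟ᵛ zeroV
      ... | yes u≡0 = u≡0
      ... | no  u≢0 = ⊥-elim (¬nonzero (lose (∈-allE u) (Vu , u≢0)))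

  line-has-nonzero : ∀ {L} → L ∈ lines → ∃ λ u → T (L u) × u ≢ zeroV
  line-has-nonzero {L} L∈ with zero-or-nonzero L
  ... | inj₂ nonzero   = nonzero
  ... | inj₁ only-zero = ⊥-elim (1≢0 (trans (sym dim≡1) dim≡0))
    where
      1≢0 : 1 ≢ 0
      1≢0 ()
      dim≡1 : dim L ≡ 1
      dim≡1 = ≡ᵇ⇒≡ (dim L) 1 (proj₂ (∈-filter⁻ (T? ∘ (λ L → dim L ≡ᵇ 1)) {xs = subspaces} L∈))
      ys = filterᵇ L allE
      bounded : ∀ {k} {vs : Vec Vector k} → vs ∈ tuples ys k → T (independent vs) → k ≤ 0
      bounded {zero}  _ _ = z≤n
      bounded {suc k} {u ∷ vs} uvs∈ ind
        with refl ← only-zero {u} (proj₂ (∈-filter⁻ (T? ∘ L) {xs = allE} (proj₁ (∈-tuples-∷⁻ uvs∈)))) =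
        ⊥-elim (¬independent-zero∷ vs ind)
      dim≡0 : dim L ≡ 0
      dim≡0 = rank≡ ys 0 z≤n bounded (inj₁ refl)

  nonzero-vector : ∀ {V} → LinearlyClosed V → ¬ T (zeroSub ==ˢ V) → ∃ λ u → T (V u) × u ≢ zeroV
  nonzero-vector {V} closed V≢0 with zero-or-nonzero V
  ... | inj₂ nonzero   = nonzero
  ... | inj₁ only-zero = ⊥-elim (V≢0 (≗⇒==ˢ zeroSub V λ u → T-extensional
          (λ u=0 → subst (T ∘ V) (sym (=ᵛ⇒≡ u=0)) (LinearlyClosed.zero∈ closed))
          (λ Vu → ≡⇒=ᵛ (only-zero Vu))))

  no-line-below≡zero : ∀ {V} → V ∈ subspaces → not (any (_⊆? V) lines) ≡ (zeroSub ==ˢ V)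
  no-line-below≡zero {V} V∈ = T-extensional
    (λ none → zero-if-no-line (to T-not-≡ none))
    (λ V≡0 → T-not⁺ λ some →
      let L , L∈ , L⊆V = find (Any.any⁻ (_⊆? V) lines some)
          u , Lu , u≢0 = line-has-nonzero L∈
      in u≢0 (=ᵛ⇒≡ (subst T (sym (==ˢ⇒≗ zeroSub V V≡0 u)) (⊆⁻ L V L⊆V Lu))))
    where
      closed = ∈subspaces⇒linearlyClosed V∈
      zero-if-no-line : any (_⊆? V) lines ≡ false → T (zeroSub ==ˢ V)
      zero-if-no-line none with zeroSub ==ˢ V in V≡0
      ... | true  = _
      ... | false =
        let u , Vu , u≢0 = nonzero-vector closed (subst T V≡0)
            open LineThrough u≢0
        in subst T none (Any.any⁺ (_⊆? V) (lose line∈lines (line⊆ closed Vu)))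

  lines-span : ⟨ lines ⟩ ≗ fullE
  lines-span v with v ≟ᵛ zeroV
  ... | yes refl = to T-≡ (LinearlyClosed.zero∈ (isSubspace⁻ ⟨ lines ⟩ (span-isSubspace (union lines))))
  ... | no  v≢0  = to T-≡ (⊆span (union lines) (Any.any⁺ (λ L → L v) (lose line∈lines ∈line)))
    where open LineThrough v≢0

-- Signed counts of spanning sets of lines

module SignedSpanningSets {q : ℕ} (F : FiniteField q) (n : ℕ) where
  open Space F n
  open Geometry F n

  signedSpanningSets : SubsetE → ℤ
  signedSpanningSets V = ∑ (sublists lines) (λ A → when (V ==ˢ ⟨ A ⟩) (sgn A))

  signedSpanningSets-resp-≗ : ∀ {V W} → V ≗ W → signedSpanningSets V ≡ signedSpanningSets W
  signedSpanningSets-resp-≗ V≗W =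
    ∑-cong (sublists lines) (λ {A} _ → cong (λ b → when b (sgn A)) (==ˢ-congˡ ⟨ A ⟩ V≗W))

  ∑-signedSpanningSets : ∀ (P : SubsetE → Bool) → (∀ {V W} → V ≗ W → P V ≡ P W) →
    ∑ subspaces (λ V → when (P V) (signedSpanningSets V))
    ≡ ∑ (sublists lines) (λ A → when (P ⟨ A ⟩) (sgn A))
  ∑-signedSpanningSets P P-resp =
    begin
      ∑ subspaces (λ V → when (P V) (signedSpanningSets V))
        ≡⟨ ∑-cong subspaces (λ {V} _ → sym (pull-in V)) ⟩
      ∑ subspaces (λ V → ∑ (sublists lines) (λ A → when (V ==ˢ ⟨ A ⟩) (when (P V) (sgn A))))
        ≡⟨ ∑-swap subspaces (sublists lines) _ ⟩
      ∑ (sublists lines) (λ A → ∑ subspaces (λ V → when (V ==ˢ ⟨ A ⟩) (when (P V) (sgn A))))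
        ≡⟨ ∑-cong (sublists lines) (λ {A} _ →
             ∑-subspaces-== (λ V → when (P V) (sgn A)) (span-isSubspace (union A))
                            (cong (λ b → when b (sgn A)) ∘ P-resp)) ⟩
      ∑ (sublists lines) (λ A → when (P ⟨ A ⟩) (sgn A)) ∎
    where
      open ≡-Reasoning
      pull-in : ∀ V → ∑ (sublists lines) (λ A → when (V ==ˢ ⟨ A ⟩) (when (P V) (sgn A)))
                      ≡ when (P V) (signedSpanningSets V)
      pull-in V = trans (∑-cong (sublists lines) (λ {A} _ → when-comm (V ==ˢ ⟨ A ⟩) (P V) (sgn A)))
                        (∑-when (sublists lines) (P V) _)

  ∑-below-signedSpanningSets : ∀ {V} → V ∈ subspaces →
    ∑ subspaces (λ Z → when (Z ⊆? V) (signedSpanningSets Z)) ≡ when (zeroSub ==ˢ V) (+ 1)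
  ∑-below-signedSpanningSets {V} V∈ =
    begin
      ∑ subspaces (λ Z → when (Z ⊆? V) (signedSpanningSets Z))
        ≡⟨ ∑-signedSpanningSets (_⊆? V) (⊆?-congˡ V) ⟩
      ∑ (sublists lines) (λ A → when (⟨ A ⟩ ⊆? V) (sgn A))
        ≡⟨ ∑-cong (sublists lines) (λ {A} _ → cong (λ b → when b (sgn A)) (⟨⟩⊆?≡all⊆? A V∈)) ⟩
      ∑ (sublists lines) (λ A → when (all (_⊆? V) A) (sgn A))
        ≡⟨ ∑-sgn-sublists-all (_⊆? V) lines ⟩
      when (not (any (_⊆? V) lines)) (+ 1)
        ≡⟨ cong (λ b → when b (+ 1)) (no-line-below≡zero V∈) ⟩
      when (zeroSub ==ˢ V) (+ 1) ∎
    where open ≡-Reasoning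

  μ≡signedSpanningSets : ∀ {V} → V ∈ subspaces → μ zeroSub V ≡ signedSpanningSets V
  μ≡signedSpanningSets V∈ =
    μ≡ zeroSub signedSpanningSets
       (λ Y∈ → ∑-subspaces-== signedSpanningSets (∈subspaces⇒isSubspace Y∈) signedSpanningSets-resp-≗)
       ∑-interval V∈ (zeroSub⊆ (∈subspaces⇒linearlyClosed V∈))
    where
      open MöbiusCharacterisation subspaces _⊆?_ _==ˢ_
             ⊆-refl (λ {U} {V} {W} → ⊆-trans U V W) (λ {V} {W} → T-∧ {V ⊆? W})
      ∑-interval : ∀ {Y} → Y ∈ subspaces → T (zeroSub ⊆? Y) →
                   ∑ subspaces (λ Z → when ((zeroSub ⊆? Z) ∧ (Z ⊆? Y)) (signedSpanningSets Z))
                   ≡ when (zeroSub ==ˢ Y) (+ 1)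
      ∑-interval {Y} Y∈ _ = trans
        (∑-cong subspaces (λ {Z} Z∈ → cong (λ b → when (b ∧ (Z ⊆? Y)) (signedSpanningSets Z))
                                           (to T-≡ (zeroSub⊆ (∈subspaces⇒linearlyClosed Z∈)))))
        (∑-below-signedSpanningSets Y∈)

theorem5p9 : ∀ {q : ℕ} (F : FiniteField q) (n : ℕ) (M : QMatroid F n) (k : ℕ) →
             χq M k ≡ χP M k
theorem5p9 F n M k =
  begin
    ∑ (filterᵇ rank-drop≡k subspaces) (μ zeroSub)
      ≡⟨ ∑-filterᵇ rank-drop≡k subspaces (μ zeroSub) ⟩
    ∑ subspaces (λ V → when (rank-drop≡k V) (μ zeroSub V))
      ≡⟨ ∑-cong subspaces (λ {V} V∈ → cong (when (rank-drop≡k V)) (μ≡signedSpanningSets V∈)) ⟩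
    ∑ subspaces (λ V → when (rank-drop≡k V) (signedSpanningSets V))
      ≡⟨ ∑-signedSpanningSets rank-drop≡k (cong (λ m → (ρ fullE ∸ m) ≡ᵇ k) ∘ ρ-ext _ _) ⟩
    ∑ (sublists lines) (λ A → when (rank-drop≡k ⟨ A ⟩) (sgn A))
      ≡⟨ ∑-cong (sublists lines) (λ {A} _ →
           cong (λ m → when ((m ∸ ρ ⟨ A ⟩) ≡ᵇ k) (sgn A)) (ρ-ext _ _ (sym ∘ lines-span))) ⟩
    ∑ (sublists lines) (λ A → when ((r M lines ∸ r M A) ≡ᵇ k) (sgn A))
      ≡⟨ sym (∑-filterᵇ _ (sublists lines) sgn) ⟩
    ∑ (filterᵇ (λ A → (r M lines ∸ r M A) ≡ᵇ k) (sublists lines)) sgn ∎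
  where
    open ≡-Reasoning
    open Space F n
    open Geometry F n
    open SignedSpanningSets F n
    open QMatroid M
    rank-drop≡k : SubsetE → Bool
    rank-drop≡k V = (ρ fullE ∸ ρ V) ≡ᵇ k
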